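{- Let $X$ be a finite connected undirected graph and $\alpha$ a $\mathbb{Z}_p$-valued voltage assignment on $X$. For $n\ge0$ let $\alpha_n$ be $\alpha$ composed with $\mathbb{Z}_p\to\mathbb{Z}/p^n\mathbb{Z}$ and $X_n=X(\mathbb{Z}/p^n\mathbb{Z},\alpha_n)$. Assume there is an integer $m_0$ such that for all $n\ge m_0$ the number of connected components of $X_n$ equals that of $X_{m_0}$. Let $\mathcal{G}_{m_0}$ be a connected component of $X_{m_0}$. Then for each $m\ge m_0$ there exists a unique subgraph $\mathcal{G}_m$ of $X_m$ (a connected component surjecting onto $\mathcal{G}_{m_0}$ under the natural projection) such that $\mathcal{G}_{m_0}\leftarrow\mathcal{G}_{m_0+1}\leftarrow\mathcal{G}_{m_0+2}\leftarrow\cdots$ is a $\mathbb{Z}_p$-tower, i.e. each $\mathcal{G}_m/\mathcal{G}_{m_0}$ is a Galois covering with Galois group isomorphic to $\mathbb{Z}/p^{m-m_0}\mathbb{Z}$.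
   Context: Graphs may have loops and multiple edges. For an undirected graph $X$, $\tilde X$ is obtained by replacing each edge by two oppositely directed edges; a $G$-valued voltage assignment on $X$ is a map $\mathbb{E}(\tilde X)\to G$ compatible with inversion of edges. The derived graph $X(G,\alpha)$ has vertices $\mathbb{V}(X)\times G$ and edges $\mathbb{E}(\tilde X)\times G$, with $(e,\sigma)$ from $(s,\sigma)$ to $(t,\sigma+\alpha(e))$ when $e$ goes from $s$ to $t$, opposite edges then being identified. The natural projections $X_{n+1}\to X_n$ are induced by $\mathbb{Z}/p^{n+1}\mathbb{Z}\to\mathbb{Z}/p^n\mathbb{Z}$. A graph covering is a surjective, locally bijective morphism of graphs; a $d$-sheeted covering (each vertex has $d$ preimages) is Galois if its group of deck transformations (automorphisms commuting with the projection) has order $d$, and this group is then its Galois group. -}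

module Defs where

open import Level using (0ℓ)
open import Data.Nat using (ℕ; zero; suc; _+_; _^_; _≤_; _∸_; NonZero)
open import Data.Nat.Properties using (m^n≢0)
open import Data.Nat.DivMod using (_mod_)
open import Data.Nat.Primality using (Prime; prime⇒nonZero)
open import Data.Fin using (Fin; toℕ)
open import Data.Bool using (Bool; T)
open import Data.Bool.Properties using (T-irrelevant)
open import Data.Product using (Σ; ∃; _×_; _,_; proj₁; proj₂)
open import Function using (_∘_)
open import Function.Bundles using (_↔_)
open import Relation.Binary.PropositionalEquality
  using (_≡_; _≢_; refl; cong; cong₂; subst; sym)

-- Graphs in Serre's sense: directed edges with an inversion.
-- (Only the law src (inv e) ≡ tgt e is recorded as a field; it is
-- needed to form induced subgraphs.)

record Graph : Set₁ where
  field
    V E     : Set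
    src tgt : E → V
    inv     : E → E
    src-inv : ∀ e → src (inv e) ≡ tgt e
open Graph public

-- A finite undirected graph X (loops and multiple edges allowed),
-- presented as its doubled graph X̃: nE directed edges, inversion is a
-- fixed-point-free involution with src (inv e) = tgt e.
record FinGraph : Set where
  field
    nV nE     : ℕ
    s t       : Fin nE → Fin nV
    ι         : Fin nE → Fin nE
    ι-invol   : ∀ e → ι (ι e) ≡ e
    ι-nofix   : ∀ e → ι e ≢ e
    s-ι       : ∀ e → s (ι e) ≡ t e
open FinGraph public

Base : FinGraph → Graph
Base X = record { V = Fin (nV X) ; E = Fin (nE X) ; src = s X ; tgt = t X
                ; inv = ι X ; src-inv = s-ι X }

data Walk (G : Graph) : V G → V G → Set where
  []  : ∀ {v} → Walk G v v
  _∷_ : ∀ (e : E G) {w} → Walk G (tgt G e) w → Walk G (src G e) w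

IsConnectedGraph : Graph → Set
IsConnectedGraph G = ∀ u v → Walk G u v

-- G has exactly k connected components: a surjective labelling of the
-- vertices by Fin k whose fibres are exactly the connectivity classes.
HasComponents : Graph → ℕ → Set
HasComponents G k =
  Σ (V G → Fin k) λ c →
    (∀ u v → c u ≡ c v → Walk G u v) ×
    (∀ u v → Walk G u v → c u ≡ c v) ×
    (∀ i → ∃ λ v → c v ≡ i)

record IsComponent (G : Graph) (S : V G → Bool) : Set where
  field
    nonempty  : ∃ λ v → T (S v)
    closed    : ∀ e → T (S (src G e)) → T (S (tgt G e))
    connected : ∀ u v → T (S u) → T (S v) → Walk G u v
open IsComponent public

private
  ΣT-≡ : {A : Set} {S : A → Bool} {x y : Σ A (T ∘ S)} →
         proj₁ x ≡ proj₁ y → x ≡ y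
  ΣT-≡ {x = a , p} {y = .a , q} refl = cong (a ,_) (T-irrelevant p q)

Sub : (G : Graph) (S : V G → Bool) →
      (∀ e → T (S (src G e)) → T (S (tgt G e))) → Graph
Sub G S cl = record
  { V = Σ (V G) (T ∘ S)
  ; E = Σ (E G) (T ∘ S ∘ src G)
  ; src = λ e → src G (proj₁ e) , proj₂ e
  ; tgt = λ e → tgt G (proj₁ e) , cl (proj₁ e) (proj₂ e)
  ; inv = λ e → inv G (proj₁ e) ,
               subst (T ∘ S) (sym (src-inv G (proj₁ e))) (cl (proj₁ e) (proj₂ e))
  ; src-inv = λ e → ΣT-≡ (src-inv G (proj₁ e))
  }

record IsCovering (G H : Graph) (fV : V G → V H) (fE : E G → E H) : Set where
  field
    src-comm : ∀ e → src H (fE e) ≡ fV (src G e)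
    tgt-comm : ∀ e → tgt H (fE e) ≡ fV (tgt G e)
    inv-comm : ∀ e → inv H (fE e) ≡ fE (inv G e)
    surjV    : ∀ h → ∃ λ g → fV g ≡ h
    locInj   : ∀ e₁ e₂ → src G e₁ ≡ src G e₂ → fE e₁ ≡ fE e₂ → e₁ ≡ e₂
    locSurj  : ∀ g e′ → src H e′ ≡ fV g →
               ∃ λ e → src G e ≡ g × fE e ≡ e′

IsSheeted : (G H : Graph) (fV : V G → V H) → ℕ → Set
IsSheeted G H fV d = ∀ h → Fin d ↔ Σ (V G) (λ g → fV g ≡ h)

record Deck (G H : Graph) (fV : V G → V H) (fE : E G → E H) : Set where
  field
    dV : V G → V G
    dE : E G → E G
    d-src  : ∀ e → src G (dE e) ≡ dV (src G e)
    d-tgt  : ∀ e → tgt G (dE e) ≡ dV (tgt G e)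
    d-inv  : ∀ e → inv G (dE e) ≡ dE (inv G e)
    overV  : ∀ v → fV (dV v) ≡ fV v
    overE  : ∀ e → fE (dE e) ≡ fE e
    dV⁻¹   : V G → V G
    dE⁻¹   : E G → E G
    dV-inv₁ : ∀ v → dV (dV⁻¹ v) ≡ v
    dV-inv₂ : ∀ v → dV⁻¹ (dV v) ≡ v
    dE-inv₁ : ∀ e → dE (dE⁻¹ e) ≡ e
    dE-inv₂ : ∀ e → dE⁻¹ (dE e) ≡ e
open Deck public

_≈D_ : ∀ {G H fV fE} → Deck G H fV fE → Deck G H fV fE → Set
_≈D_ {G} δ δ′ = (∀ v → dV δ v ≡ dV δ′ v) × (∀ e → dE δ e ≡ dE δ′ e)

-- Addition in ℤ/Nℤ, represented by Fin N.
add : ∀ N .{{_ : NonZero N}} → Fin N → Fin N → Fin N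
add N a b = (toℕ a + toℕ b) mod N

-- The deck transformation group of (fV , fE) is isomorphic to ℤ/Nℤ:
-- a bijection Φ from ℤ/Nℤ onto the deck transformations (up to ≈D)
-- turning addition into composition.
DeckGroup≅ℤ/ : (G H : Graph) (fV : V G → V H) (fE : E G → E H) →
               (N : ℕ) .{{_ : NonZero N}} → Set
DeckGroup≅ℤ/ G H fV fE N =
  Σ (Fin N → Deck G H fV fE) λ Φ →
    (∀ a b → (∀ v → dV (Φ (add N a b)) v ≡ dV (Φ a) (dV (Φ b) v)) ×
             (∀ e → dE (Φ (add N a b)) e ≡ dE (Φ a) (dE (Φ b) e))) ×
    (∀ a b → Φ a ≈D Φ b → a ≡ b) ×
    (∀ δ → ∃ λ a → Φ a ≈D δ)

-- (fV , fE) is a Galois covering whose Galois group is isomorphic to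
-- ℤ/Nℤ: an N-sheeted covering whose deck group (hence of order N) is
-- isomorphic to ℤ/Nℤ.
IsGaloisCyclic : (G H : Graph) (fV : V G → V H) (fE : E G → E H) →
                 (N : ℕ) .{{_ : NonZero N}} → Set
IsGaloisCyclic G H fV fE N =
  IsCovering G H fV fE × IsSheeted G H fV N × DeckGroup≅ℤ/ G H fV fE N

module Tower (p : ℕ) (pr : Prime p) where

  instance
    p≢0 : NonZero p
    p≢0 = prime⇒nonZero pr

  pⁿ≢0 : ∀ n → NonZero (p ^ n)
  pⁿ≢0 n = m^n≢0 p n

  -- ℤ_p = lim ℤ/pⁿ : compatible systems of residues.
  record ℤp : Set where
    field
      res    : (n : ℕ) → Fin (p ^ n)
      compat : ∀ n → _mod_ (toℕ (res (suc n))) (p ^ n) {{pⁿ≢0 n}} ≡ res n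
  open ℤp public

  SumZero : ℤp → ℤp → Set
  SumZero x y = ∀ n → add (p ^ n) {{pⁿ≢0 n}} (res x n) (res y n) ≡ _mod_ 0 (p ^ n) {{pⁿ≢0 n}}

  record Voltage (X : FinGraph) : Set where
    field
      α     : Fin (nE X) → ℤp
      α-inv : ∀ e → SumZero (α (ι X e)) (α e)
  open Voltage public

  αₙ : ∀ {X} → Voltage X → (n : ℕ) → Fin (nE X) → Fin (p ^ n)
  αₙ a n e = res (α a e) n

  Derived : (X : FinGraph) → Voltage X → ℕ → Graph
  Derived X a n = record
    { V = Fin (nV X) × Fin (p ^ n)
    ; E = Fin (nE X) × Fin (p ^ n)
    ; src = λ x → s X (proj₁ x) , proj₂ x
    ; tgt = λ x → t X (proj₁ x) , (add (p ^ n) {{pⁿ≢0 n}} (proj₂ x) (αₙ a n (proj₁ x)))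
    ; inv = λ x → ι X (proj₁ x) , (add (p ^ n) {{pⁿ≢0 n}} (proj₂ x) (αₙ a n (proj₁ x)))
    ; src-inv = λ x → cong (_, (add (p ^ n) {{pⁿ≢0 n}} (proj₂ x) (αₙ a n (proj₁ x)))) (s-ι X (proj₁ x))
    }

  red : ∀ m k → Fin (p ^ m) → Fin (p ^ k)
  red m k σ = _mod_ (toℕ σ) (p ^ k) {{pⁿ≢0 k}}

  πV : ∀ {X a} m k → V (Derived X a m) → V (Derived X a k)
  πV m k x = proj₁ x , red m k (proj₂ x)

  πE : ∀ {X a} m k → E (Derived X a m) → E (Derived X a k)
  πE m k x = proj₁ x , red m k (proj₂ x)

  MapsInto : ∀ {X a} m k → (V (Derived X a m) → Bool) →
             (V (Derived X a k) → Bool) → Set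
  MapsInto {X} {a} m k S S₀ = ∀ v → T (S v) → T (S₀ (πV {X} {a} m k v))

  πV∣ : ∀ {X a} m k {S S₀} → MapsInto {X} {a} m k S S₀ →
        Σ (V (Derived X a m)) (T ∘ S) → Σ (V (Derived X a k)) (T ∘ S₀)
  πV∣ {X} {a} m k into x = πV {X} {a} m k (proj₁ x) , into (proj₁ x) (proj₂ x)

  πE∣ : ∀ {X a} m k {S S₀} → MapsInto {X} {a} m k S S₀ →
        Σ (E (Derived X a m)) (T ∘ S ∘ src (Derived X a m)) →
        Σ (E (Derived X a k)) (T ∘ S₀ ∘ src (Derived X a k))
  πE∣ {X} {a} m k into x =
    πE {X} {a} m k (proj₁ x) , into (src (Derived X a m) (proj₁ x)) (proj₂ x)

  Surjects : ∀ {X a} m k → (V (Derived X a m) → Bool) →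
             (V (Derived X a k) → Bool) → Set
  Surjects {X} {a} m k S S₀ =
    ∀ w → T (S₀ w) → ∃ λ v → T (S v) × πV {X} {a} m k v ≡ w

{-# OPTIONS --safe #-}
-- The projection π : Xₘ → Xₘ₀, (v , σ) ↦ (v , σ mod pᵐ⁰), is surjective and maps walks to walks,
-- so it induces a surjection from the k components of Xₘ onto the k components of Xₘ₀. A
-- surjection Fin k → Fin k is a bijection, so 𝒢ₘ := π⁻¹(𝒢ₘ₀) is connected and is the only
-- component of Xₘ above 𝒢ₘ₀. Writing σ ∈ ℤ/pᵐ as σ₀ + i·pᵐ⁰ with σ₀ < pᵐ⁰ and i < pᵐ⁻ᵐ⁰, the
-- fibre of π over (v , σ₀) is indexed by i, and the translations σ ↦ σ + j·pᵐ⁰ are deck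
-- transformations realising ℤ/pᵐ⁻ᵐ⁰. As 𝒢ₘ is connected and π is locally injective, a deck
-- transformation is determined by the image of a single vertex, so there are no others.
module Submission where

open import Defs
open import Data.Nat using (ℕ; suc; _+_; _*_; _∸_; _^_; _≤_; _<_; _≤′_; ≤′-refl; ≤′-step; NonZero)
open import Data.Nat.Properties
  using (1+n≰n; *-comm; m≤m*n; ^-distribˡ-+-*; m∸n+n≡m; m+[n∸m]≡n; +-monoˡ-<; *-monoˡ-≤;
         <⇒≤; ≤-refl; ≤⇒≤′; ≤′⇒≤; module ≤-Reasoning)
open import Data.Nat.DivMod
  using (_%_; _/_; _mod_; m%n<n; m<n⇒m%n≡m; m%n%n≡m%n; %-distribˡ-+; [m+kn]%n≡m%n;
         [m+n]%n≡m%n; m≡m%n+[m/n]*n; m∣n⇒o%n%m≡o%m; m<n*o⇒m/o<n; +-distrib-/-∣ʳ;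
         m<n⇒m/n≡0; m*n/n≡m)
open import Data.Nat.Divisibility using (_∣_; divides; n∣m*n)
open import Data.Nat.Primality using (Prime)
open import Data.Nat.Tactic.RingSolver using (solve-∀)
open import Data.Fin using (Fin; toℕ; fromℕ<; inject≤; punchOut; _≟_)
open import Data.Fin.Properties
  using (toℕ-injective; toℕ-fromℕ<; toℕ-inject≤; toℕ<n; fromℕ<-cong; fromℕ<-toℕ;
         punchOut-injective; injective⇒≤; any?)
open import Data.Bool using (Bool; true; false; T)
open import Data.Bool.Properties using (T-irrelevant)
open import Data.Empty using (⊥-elim)
open import Data.Unit using (tt)
open import Data.Product using (Σ; ∃; _×_; _,_; proj₁; proj₂)
open import Data.Product.Properties using (≡-dec)
open import Function using (_∘_)
open import Function.Bundles using (mk↔ₛ′)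
open import Function.Definitions using (Injective)
open import Relation.Binary.Definitions using (DecidableEquality)
open import Relation.Binary.PropositionalEquality
  using (_≡_; _≢_; refl; sym; trans; cong; cong₂; subst; module ≡-Reasoning)
open import Relation.Nullary using (yes; no; contradiction)
open import Axiom.UniquenessOfIdentityProofs using (module Decidable⇒UIP)

injective⇒surjective : ∀ {n} {g : Fin n → Fin n} → Injective _≡_ _≡_ g →
                       ∀ i → ∃ λ x → g x ≡ i
injective⇒surjective {suc n} {g} g-inj i with any? (λ x → g x ≟ i)
... | yes hit = hit
... | no miss = contradiction (injective⇒≤ punched-inj) 1+n≰n
  where
  avoids : ∀ x → i ≢ g x
  avoids x i≡gx = miss (x , sym i≡gx)
  punched : Fin (suc n) → Fin n
  punched x = punchOut (avoids x)
  punched-inj : Injective _≡_ _≡_ punched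
  punched-inj eq = g-inj (punchOut-injective (avoids _) (avoids _) eq)

surjective⇒injective : ∀ {n} {f : Fin n → Fin n} → (∀ y → ∃ λ x → f x ≡ y) →
                       Injective _≡_ _≡_ f
surjective⇒injective {n} {f} f-surj {i} {j} fi≡fj =
  trans (sym (section-retracts i)) (trans (cong section fi≡fj) (section-retracts j))
  where
  section : Fin n → Fin n
  section y = proj₁ (f-surj y)
  f∘section : ∀ y → f (section y) ≡ y
  f∘section y = proj₂ (f-surj y)
  section-inj : Injective _≡_ _≡_ section
  section-inj {y} {y′} eq = trans (sym (f∘section y)) (trans (cong f eq) (f∘section y′))
  section-retracts : ∀ x → section (f x) ≡ x
  section-retracts x with (y , refl) ← injective⇒surjective section-inj x =
    cong section (f∘section y)

T-ext : ∀ {x y} → (T x → T y) → (T y → T x) → x ≡ y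
T-ext {false} {false} _ _ = refl
T-ext {false} {true}  _ g = ⊥-elim (g tt)
T-ext {true}  {false} f _ = ⊥-elim (f tt)
T-ext {true}  {true}  _ _ = refl

ΣT-≡ : {A : Set} {S : A → Bool} {x y : Σ A (T ∘ S)} → proj₁ x ≡ proj₁ y → x ≡ y
ΣT-≡ {x = a , _} {y = .a , _} refl = cong (a ,_) (T-irrelevant _ _)

ΣT-≟ : {A : Set} {S : A → Bool} → DecidableEquality A → DecidableEquality (Σ A (T ∘ S))
ΣT-≟ _≟ᴬ_ (x , _) (y , _) with x ≟ᴬ y
... | yes x≡y = yes (ΣT-≡ x≡y)
... | no  x≢y = no (x≢y ∘ cong proj₁)

fibre-≡ : {A B : Set} {f : A → B} {b : B} → DecidableEquality B →
          {x y : Σ A (λ a → f a ≡ b)} → proj₁ x ≡ proj₁ y → x ≡ y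
fibre-≡ _≟ᴮ_ {x , p} {.x , q} refl = cong (x ,_) (Decidable⇒UIP.≡-irrelevant _≟ᴮ_ p q)

toℕ-mod : ∀ m n .{{_ : NonZero n}} → toℕ (m mod n) ≡ m % n
toℕ-mod m n = toℕ-fromℕ< (m%n<n m n)

mod-cong : ∀ {m o} n .{{_ : NonZero n}} → m % n ≡ o % n → m mod n ≡ o mod n
mod-cong {m} {o} n eq = fromℕ<-cong (m % n) (o % n) eq (m%n<n m n) (m%n<n o n)

toℕ-mod-id : ∀ {n} .{{_ : NonZero n}} (σ : Fin n) → toℕ σ mod n ≡ σ
toℕ-mod-id {n} σ =
  trans (fromℕ<-cong _ _ (m<n⇒m%n≡m (toℕ<n σ)) (m%n<n (toℕ σ) n) (toℕ<n σ))
        (fromℕ<-toℕ σ (toℕ<n σ))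

mod-mod : ∀ {K M} .{{_ : NonZero K}} .{{_ : NonZero M}} → K ∣ M →
          ∀ n → toℕ (n mod M) mod K ≡ n mod K
mod-mod {K} {M} K∣M n =
  mod-cong K (trans (cong (_% K) (toℕ-mod n M)) (m∣n⇒o%n%m≡o%m K M n K∣M))

[m%n+o]%n≡[m+o]%n : ∀ m o n .{{_ : NonZero n}} → (m % n + o) % n ≡ (m + o) % n
[m%n+o]%n≡[m+o]%n m o n = begin
  (m % n + o) % n           ≡⟨ %-distribˡ-+ (m % n) o n ⟩
  (m % n % n + o % n) % n   ≡⟨ cong (λ r → (r + o % n) % n) (m%n%n≡m%n m n) ⟩
  (m % n + o % n) % n       ≡⟨ %-distribˡ-+ m o n ⟨
  (m + o) % n               ∎
  where open ≡-Reasoning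

^-monoʳ-∣ : ∀ p {k m} → k ≤ m → p ^ k ∣ p ^ m
^-monoʳ-∣ p {k} {m} k≤m = divides (p ^ (m ∸ k)) (begin
  p ^ m                 ≡⟨ cong (p ^_) (m∸n+n≡m k≤m) ⟨
  p ^ (m ∸ k + k)       ≡⟨ ^-distribˡ-+-* p (m ∸ k) k ⟩
  p ^ (m ∸ k) * p ^ k   ∎)
  where open ≡-Reasoning

module Layers (K N M : ℕ) .{{_ : NonZero K}} .{{_ : NonZero N}} .{{_ : NonZero M}}
              (N*K≡M : N * K ≡ M) where

  K∣M : K ∣ M
  K∣M = divides N (sym N*K≡M)

  K≤M : K ≤ M
  K≤M = subst (K ≤_) (trans (*-comm K N) N*K≡M) (m≤m*n K N)

  reduce : Fin M → Fin K
  reduce σ = toℕ σ mod K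

  level : Fin M → Fin N
  level σ = fromℕ< (m<n*o⇒m/o<n (subst (toℕ σ <_) (sym N*K≡M) (toℕ<n σ)))

  embed : Fin K → Fin M
  embed σ₀ = inject≤ σ₀ K≤M

  shift : ℕ → Fin M → Fin M
  shift j σ = (toℕ σ + j * K) mod M

  toℕ-level : ∀ σ → toℕ (level σ) ≡ toℕ σ / K
  toℕ-level σ = toℕ-fromℕ< _

  reduce-add : ∀ σ τ → reduce (add M σ τ) ≡ add K (reduce σ) (reduce τ)
  reduce-add σ τ = trans (mod-mod K∣M (toℕ σ + toℕ τ)) (mod-cong K (begin
    (toℕ σ + toℕ τ) % K                    ≡⟨ %-distribˡ-+ (toℕ σ) (toℕ τ) K ⟩
    (toℕ σ % K + toℕ τ % K) % K            ≡⟨ cong₂ (λ r s → (r + s) % K) (toℕ-mod _ K) (toℕ-mod _ K) ⟨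
    (toℕ (reduce σ) + toℕ (reduce τ)) % K  ∎))
    where open ≡-Reasoning

  reduce-embed : ∀ σ₀ → reduce (embed σ₀) ≡ σ₀
  reduce-embed σ₀ = trans (cong (_mod K) (toℕ-inject≤ σ₀ K≤M)) (toℕ-mod-id σ₀)

  reduce-shift : ∀ j σ → reduce (shift j σ) ≡ reduce σ
  reduce-shift j σ =
    trans (mod-mod K∣M (toℕ σ + j * K)) (mod-cong K ([m+kn]%n≡m%n (toℕ σ) j K))

  shift-shift : ∀ i j σ → shift i (shift j σ) ≡ shift (i + j) σ
  shift-shift i j σ = mod-cong M (begin
    (toℕ (shift j σ) + i * K) % M      ≡⟨ cong (λ r → (r + i * K) % M) (toℕ-mod _ M) ⟩
    ((toℕ σ + j * K) % M + i * K) % M  ≡⟨ [m%n+o]%n≡[m+o]%n (toℕ σ + j * K) (i * K) M ⟩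
    (toℕ σ + j * K + i * K) % M        ≡⟨ cong (_% M) (collect (toℕ σ) i j K) ⟩
    (toℕ σ + (i + j) * K) % M          ∎)
    where
    open ≡-Reasoning
    collect : ∀ s i j k → s + j * k + i * k ≡ s + (i + j) * k
    collect = solve-∀

  shift-cancel : ∀ i j → i + j ≡ N → ∀ σ → shift i (shift j σ) ≡ σ
  shift-cancel i j i+j≡N σ = begin
    shift i (shift j σ)          ≡⟨ shift-shift i j σ ⟩
    (toℕ σ + (i + j) * K) mod M  ≡⟨ cong (λ r → (toℕ σ + r * K) mod M) i+j≡N ⟩
    (toℕ σ + N * K) mod M        ≡⟨ cong (λ r → (toℕ σ + r) mod M) N*K≡M ⟩
    (toℕ σ + M) mod M            ≡⟨ mod-cong M ([m+n]%n≡m%n (toℕ σ) M) ⟩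
    toℕ σ mod M                  ≡⟨ toℕ-mod-id σ ⟩
    σ                            ∎
    where open ≡-Reasoning

  shift-add : ∀ j σ τ → shift j (add M σ τ) ≡ add M (shift j σ) τ
  shift-add j σ τ = mod-cong M (begin
    (toℕ (add M σ τ) + j * K) % M      ≡⟨ cong (λ r → (r + j * K) % M) (toℕ-mod _ M) ⟩
    ((toℕ σ + toℕ τ) % M + j * K) % M  ≡⟨ [m%n+o]%n≡[m+o]%n (toℕ σ + toℕ τ) (j * K) M ⟩
    (toℕ σ + toℕ τ + j * K) % M        ≡⟨ cong (_% M) (swap (toℕ σ) (toℕ τ) (j * K)) ⟩
    (toℕ σ + j * K + toℕ τ) % M        ≡⟨ [m%n+o]%n≡[m+o]%n (toℕ σ + j * K) (toℕ τ) M ⟨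
    ((toℕ σ + j * K) % M + toℕ τ) % M  ≡⟨ cong (λ r → (r + toℕ τ) % M) (toℕ-mod _ M) ⟨
    (toℕ (shift j σ) + toℕ τ) % M      ∎)
    where
    open ≡-Reasoning
    swap : ∀ a b c → a + b + c ≡ a + c + b
    swap = solve-∀

  shift-mod : ∀ j σ → shift (toℕ (j mod N)) σ ≡ shift j σ
  shift-mod j σ = mod-cong M (begin
    (toℕ σ + toℕ (j mod N) * K) % M            ≡⟨ cong (λ r → (toℕ σ + r * K) % M) (toℕ-mod j N) ⟩
    (toℕ σ + j % N * K) % M                    ≡⟨ [m+kn]%n≡m%n _ (j / N) M ⟨
    (toℕ σ + j % N * K + j / N * M) % M        ≡⟨ cong (λ r → (toℕ σ + j % N * K + j / N * r) % M) N*K≡M ⟨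
    (toℕ σ + j % N * K + j / N * (N * K)) % M  ≡⟨ cong (_% M) (collect (toℕ σ) (j % N) (j / N) N K) ⟩
    (toℕ σ + (j % N + j / N * N) * K) % M      ≡⟨ cong (λ r → (toℕ σ + r * K) % M) (m≡m%n+[m/n]*n j N) ⟨
    (toℕ σ + j * K) % M                        ∎)
    where
    open ≡-Reasoning
    collect : ∀ s r q n k → s + r * k + q * (n * k) ≡ s + (r + q * n) * k
    collect = solve-∀

  shift-hom : ∀ (i j : Fin N) σ → shift (toℕ (add N i j)) σ ≡ shift (toℕ i) (shift (toℕ j) σ)
  shift-hom i j σ = trans (shift-mod (toℕ i + toℕ j) σ) (sym (shift-shift (toℕ i) (toℕ j) σ))

  layer-bound : ∀ (σ₀ : Fin K) (i : Fin N) → toℕ σ₀ + toℕ i * K < M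
  layer-bound σ₀ i = begin-strict
    toℕ σ₀ + toℕ i * K  <⟨ +-monoˡ-< (toℕ i * K) (toℕ<n σ₀) ⟩
    suc (toℕ i) * K     ≤⟨ *-monoˡ-≤ K (toℕ<n i) ⟩
    N * K               ≡⟨ N*K≡M ⟩
    M                   ∎
    where open ≤-Reasoning

  level-shift-embed : ∀ i σ₀ → level (shift (toℕ i) (embed σ₀)) ≡ i
  level-shift-embed i σ₀ = toℕ-injective (begin
    toℕ (level (shift (toℕ i) (embed σ₀)))  ≡⟨ toℕ-level _ ⟩
    toℕ (shift (toℕ i) (embed σ₀)) / K      ≡⟨ cong (_/ K) (toℕ-mod _ M) ⟩
    (toℕ (embed σ₀) + toℕ i * K) % M / K    ≡⟨ cong (λ r → (r + toℕ i * K) % M / K) (toℕ-inject≤ σ₀ K≤M) ⟩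
    (toℕ σ₀ + toℕ i * K) % M / K            ≡⟨ cong (_/ K) (m<n⇒m%n≡m (layer-bound σ₀ i)) ⟩
    (toℕ σ₀ + toℕ i * K) / K                ≡⟨ +-distrib-/-∣ʳ (toℕ σ₀) (n∣m*n (toℕ i)) ⟩
    toℕ σ₀ / K + toℕ i * K / K              ≡⟨ cong₂ _+_ (m<n⇒m/n≡0 (toℕ<n σ₀)) (m*n/n≡m (toℕ i) K) ⟩
    toℕ i                                   ∎)
    where open ≡-Reasoning

  shift-level-embed-reduce : ∀ σ → shift (toℕ (level σ)) (embed (reduce σ)) ≡ σ
  shift-level-embed-reduce σ = begin
    (toℕ (embed (reduce σ)) + toℕ (level σ) * K) mod M
      ≡⟨ cong₂ (λ r q → (r + q * K) mod M) (toℕ-inject≤ (reduce σ) K≤M) (toℕ-level σ) ⟩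
    (toℕ (reduce σ) + toℕ σ / K * K) mod M
      ≡⟨ cong (λ r → (r + toℕ σ / K * K) mod M) (toℕ-mod (toℕ σ) K) ⟩
    (toℕ σ % K + toℕ σ / K * K) mod M
      ≡⟨ cong (_mod M) (m≡m%n+[m/n]*n (toℕ σ) K) ⟨
    toℕ σ mod M
      ≡⟨ toℕ-mod-id σ ⟩
    σ ∎
    where open ≡-Reasoning

walk-closed : ∀ {G : Graph} {S : V G → Bool} → (∀ e → T (S (src G e)) → T (S (tgt G e))) →
              ∀ {u v} → Walk G u v → T (S u) → T (S v)
walk-closed cl []      u∈S = u∈S
walk-closed cl (e ∷ w) u∈S = walk-closed cl w (cl e u∈S)

map-walk : ∀ {G H : Graph} (fV : V G → V H) (fE : E G → E H) →
           (∀ e → src H (fE e) ≡ fV (src G e)) → (∀ e → tgt H (fE e) ≡ fV (tgt G e)) →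
           ∀ {u v} → Walk G u v → Walk H (fV u) (fV v)
map-walk         fV fE src-comm tgt-comm []            = []
map-walk {H = H} fV fE src-comm tgt-comm (_∷_ e {v} w) =
  subst (λ x → Walk H x (fV v)) (src-comm e)
    (fE e ∷ subst (λ x → Walk H x (fV v)) (sym (tgt-comm e))
                  (map-walk fV fE src-comm tgt-comm w))

sub-walk : ∀ {G : Graph} {S : V G → Bool} (cl : ∀ e → T (S (src G e)) → T (S (tgt G e))) →
           ∀ {u v} → Walk G u v → (u∈S : T (S u)) (v∈S : T (S v)) →
           Walk (Sub G S cl) (u , u∈S) (v , v∈S)
sub-walk {G} {S} cl {u} [] u∈S v∈S =
  subst (λ q → Walk (Sub G S cl) (u , u∈S) (u , q)) (T-irrelevant u∈S v∈S) []
sub-walk cl (e ∷ w) u∈S v∈S = (e , u∈S) ∷ sub-walk cl w (cl e u∈S) v∈S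

component-connected : ∀ {G S} (c : IsComponent G S) → IsConnectedGraph (Sub G S (closed c))
component-connected c (u , u∈S) (v , v∈S) =
  sub-walk (closed c) (connected c u v u∈S v∈S) u∈S v∈S

component-unique : ∀ {G S S′} → IsComponent G S → IsComponent G S′ →
                   (∀ v → T (S′ v) → T (S v)) → ∀ v → S′ v ≡ S v
component-unique {S = S} {S′} c c′ S′⊆S v = T-ext (S′⊆S v) (fills (nonempty c′))
  where
  fills : (∃ λ w → T (S′ w)) → T (S v) → T (S′ v)
  fills (w , w∈S′) v∈S = walk-closed (closed c′) (connected c w v (S′⊆S w w∈S′) v∈S) w∈S′

same-component-count⇒reflects-walks :
  ∀ {G H : Graph} {k} (f : V G → V H) →
  (∀ {u v} → Walk G u v → Walk H (f u) (f v)) → (∀ h → ∃ λ g → f g ≡ h) →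
  HasComponents G k → HasComponents H k →
  ∀ u v → Walk H (f u) (f v) → Walk G u v
same-component-count⇒reflects-walks {k = k} f f-walk f-surj
  (cG , cG-walk , walk-cG , cG-surj) (cH , _ , walk-cH , cH-surj) u v fu⇝fv =
  cG-walk u v (surjective⇒injective φ-surj
    (trans (φ∘cG u) (trans (walk-cH _ _ fu⇝fv) (sym (φ∘cG v)))))
  where
  φ : Fin k → Fin k
  φ i = cH (f (proj₁ (cG-surj i)))
  φ∘cG : ∀ g → φ (cG g) ≡ cH (f g)
  φ∘cG g = walk-cH _ _ (f-walk (cG-walk _ g (proj₂ (cG-surj (cG g)))))
  φ-surj : ∀ j → ∃ λ i → φ i ≡ j
  φ-surj j =
    let (w , cHw≡j) = cH-surj j ; (g , fg≡w) = f-surj w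
    in  cG g , trans (φ∘cG g) (trans (cong cH fg≡w) cHw≡j)

deck-determined : ∀ {G H fV fE} → IsCovering G H fV fE → IsConnectedGraph G →
                  (δ δ′ : Deck G H fV fE) → ∀ g → dV δ g ≡ dV δ′ g → δ ≈D δ′
deck-determined {G} cov G-connected δ δ′ g δg≡δ′g = agree-on-vertex , agree-on-edge
  where
  agree-on-edge-from : ∀ e → dV δ (src G e) ≡ dV δ′ (src G e) → dE δ e ≡ dE δ′ e
  agree-on-edge-from e eq = IsCovering.locInj cov (dE δ e) (dE δ′ e)
    (trans (d-src δ e) (trans eq (sym (d-src δ′ e))))
    (trans (overE δ e) (sym (overE δ′ e)))
  propagate : ∀ {u v} → Walk G u v → dV δ u ≡ dV δ′ u → dV δ v ≡ dV δ′ v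
  propagate []      eq = eq
  propagate (e ∷ w) eq = propagate w
    (trans (sym (d-tgt δ e)) (trans (cong (tgt G) (agree-on-edge-from e eq)) (d-tgt δ′ e)))
  agree-on-vertex : ∀ v → dV δ v ≡ dV δ′ v
  agree-on-vertex v = propagate (G-connected g v) δg≡δ′g
  agree-on-edge : ∀ e → dE δ e ≡ dE δ′ e
  agree-on-edge e = agree-on-edge-from e (agree-on-vertex (src G e))

module _ {p : ℕ} (pr : Prime p) where
  open Tower p pr

  res-reduce : ∀ x {k m} → k ≤′ m → red m k (res x m) ≡ res x k
  res-reduce x {k} ≤′-refl = toℕ-mod-id {{pⁿ≢0 k}} (res x k)
  res-reduce x {k} (≤′-step {m} k≤′m) = begin
    red (suc m) k (res x (suc m))
      ≡⟨ mod-mod {{pⁿ≢0 k}} {{pⁿ≢0 m}} (^-monoʳ-∣ p (≤′⇒≤ k≤′m)) _ ⟨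
    red m k (red (suc m) m (res x (suc m)))  ≡⟨ cong (red m k) (compat x m) ⟩
    red m k (res x m)                        ≡⟨ res-reduce x k≤′m ⟩
    res x k                                  ∎
    where open ≡-Reasoning

module Projection {p : ℕ} {pr : Prime p} (X : FinGraph) (a : Tower.Voltage p pr X)
                  {m₀ m : ℕ} (m₀≤m : m₀ ≤ m) where
  open Tower p pr

  K N M : ℕ
  K = p ^ m₀
  N = p ^ (m ∸ m₀)
  M = p ^ m

  instance
    K≢0 : NonZero K
    K≢0 = pⁿ≢0 m₀
    N≢0 : NonZero N
    N≢0 = pⁿ≢0 (m ∸ m₀)
    M≢0 : NonZero M
    M≢0 = pⁿ≢0 m

  N*K≡M : N * K ≡ M
  N*K≡M = trans (sym (^-distribˡ-+-* p (m ∸ m₀) m₀)) (cong (p ^_) (m∸n+n≡m m₀≤m))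

  open Layers K N M N*K≡M

  Xₘ X₀ : Graph
  Xₘ = Derived X a m
  X₀ = Derived X a m₀

  π : V Xₘ → V X₀
  π = πV {X} {a} m m₀

  πₑ : E Xₘ → E X₀
  πₑ = πE {X} {a} m m₀

  reduce-translate : ∀ x σ → add K (reduce σ) (αₙ a m₀ x) ≡ reduce (add M σ (αₙ a m x))
  reduce-translate x σ = begin
    add K (reduce σ) (αₙ a m₀ x)
      ≡⟨ cong (add K (reduce σ)) (res-reduce pr (α a x) (≤⇒≤′ m₀≤m)) ⟨
    add K (reduce σ) (reduce (αₙ a m x))  ≡⟨ reduce-add σ (αₙ a m x) ⟨
    reduce (add M σ (αₙ a m x))           ∎
    where open ≡-Reasoning

  tgt-π : ∀ e → tgt X₀ (πₑ e) ≡ π (tgt Xₘ e)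
  tgt-π (x , σ) = cong (t X x ,_) (reduce-translate x σ)

  π-walk : ∀ {u v} → Walk Xₘ u v → Walk X₀ (π u) (π v)
  π-walk = map-walk π πₑ (λ _ → refl) tgt-π

  lift : V X₀ → V Xₘ
  lift (v , σ₀) = v , embed σ₀

  π∘lift : ∀ w → π (lift w) ≡ w
  π∘lift (v , σ₀) = cong (v ,_) (reduce-embed σ₀)

  module Preimage (S₀ : V X₀ → Bool) (c₀ : IsComponent X₀ S₀) {k : ℕ}
                  (kₘ : HasComponents Xₘ k) (k₀ : HasComponents X₀ k) where

    S : V Xₘ → Bool
    S = S₀ ∘ π

    S-maps-into : MapsInto {X} {a} m m₀ S S₀
    S-maps-into _ v∈S = v∈S

    S-closed : ∀ e → T (S (src Xₘ e)) → T (S (tgt Xₘ e))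
    S-closed e e∈S = subst (T ∘ S₀) (tgt-π e) (closed c₀ (πₑ e) e∈S)

    G H : Graph
    G = Sub Xₘ S S-closed
    H = Sub X₀ S₀ (closed c₀)

    fV : V G → V H
    fV = πV∣ {X} {a} m m₀ {S} {S₀} S-maps-into

    fE : E G → E H
    fE = πE∣ {X} {a} m m₀ {S} {S₀} S-maps-into

    liftH : V H → V G
    liftH (w , w∈S₀) = lift w , subst (T ∘ S₀) (sym (π∘lift w)) w∈S₀

    fV∘liftH : ∀ h → fV (liftH h) ≡ h
    fV∘liftH (w , _) = ΣT-≡ (π∘lift w)

    S-component : IsComponent Xₘ S
    S-component = record
      { nonempty  = liftH (nonempty c₀)
      ; closed    = S-closed
      ; connected = λ u v u∈S v∈S →
          same-component-count⇒reflects-walks π π-walk (λ w → lift w , π∘lift w) kₘ k₀ u v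
            (connected c₀ (π u) (π v) u∈S v∈S)
      }

    covering : IsCovering G H fV fE
    covering = record
      { src-comm = λ _ → refl
      ; tgt-comm = λ e → ΣT-≡ (tgt-π (proj₁ e))
      ; inv-comm = λ { ((x , σ) , _) → ΣT-≡ (cong (ι X x ,_) (reduce-translate x σ)) }
      ; surjV    = λ h → liftH h , fV∘liftH h
      ; locInj   = λ _ _ same-src same-image →
          ΣT-≡ (cong₂ _,_ (cong (proj₁ ∘ proj₁) same-image) (cong (proj₂ ∘ proj₁) same-src))
      ; locSurj  = λ { ((_ , σ) , _) ((x , _) , x∈S₀) src≡ →
          ((x , σ) , subst (λ ρ → T (S₀ (s X x , ρ))) (cong (proj₂ ∘ proj₁) src≡) x∈S₀) ,
          ΣT-≡ (cong (_, σ) (cong (proj₁ ∘ proj₁) src≡)) ,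
          ΣT-≡ (cong (x ,_) (sym (cong (proj₂ ∘ proj₁) src≡))) }
      }

    shiftV : ℕ → V G → V G
    shiftV j ((v , σ) , v∈S) =
      (v , shift j σ) , subst (λ ρ → T (S₀ (v , ρ))) (sym (reduce-shift j σ)) v∈S

    shiftE : ℕ → E G → E G
    shiftE j ((x , σ) , x∈S) =
      (x , shift j σ) , subst (λ ρ → T (S₀ (s X x , ρ))) (sym (reduce-shift j σ)) x∈S

    shiftV-cancel : ∀ i j → i + j ≡ N → ∀ v → shiftV i (shiftV j v) ≡ v
    shiftV-cancel i j i+j≡N ((v , σ) , _) = ΣT-≡ (cong (v ,_) (shift-cancel i j i+j≡N σ))

    shiftE-cancel : ∀ i j → i + j ≡ N → ∀ e → shiftE i (shiftE j e) ≡ e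
    shiftE-cancel i j i+j≡N ((x , σ) , _) = ΣT-≡ (cong (x ,_) (shift-cancel i j i+j≡N σ))

    deck : Fin N → Deck G H fV fE
    deck i = record
      { dV = shiftV j ; dE = shiftE j
      ; d-src = λ _ → ΣT-≡ refl
      ; d-tgt = λ { ((x , σ) , _) → ΣT-≡ (cong (t X x ,_) (sym (shift-add j σ (αₙ a m x)))) }
      ; d-inv = λ { ((x , σ) , _) → ΣT-≡ (cong (ι X x ,_) (sym (shift-add j σ (αₙ a m x)))) }
      ; overV = λ { ((v , σ) , _) → ΣT-≡ (cong (v ,_) (reduce-shift j σ)) }
      ; overE = λ { ((x , σ) , _) → ΣT-≡ (cong (x ,_) (reduce-shift j σ)) }
      ; dV⁻¹ = shiftV (N ∸ j) ; dE⁻¹ = shiftE (N ∸ j)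
      ; dV-inv₁ = shiftV-cancel j (N ∸ j) (m+[n∸m]≡n j≤N)
      ; dV-inv₂ = shiftV-cancel (N ∸ j) j (m∸n+n≡m j≤N)
      ; dE-inv₁ = shiftE-cancel j (N ∸ j) (m+[n∸m]≡n j≤N)
      ; dE-inv₂ = shiftE-cancel (N ∸ j) j (m∸n+n≡m j≤N)
      }
      where
      j : ℕ
      j = toℕ i
      j≤N : j ≤ N
      j≤N = <⇒≤ (toℕ<n i)

    fibre-index : V G → Fin N
    fibre-index ((_ , σ) , _) = level σ

    fibre-index-deck : ∀ i h → fibre-index (dV (deck i) (liftH h)) ≡ i
    fibre-index-deck i ((_ , σ₀) , _) = level-shift-embed i σ₀

    deck-fibre-index : ∀ g → dV (deck (fibre-index g)) (liftH (fV g)) ≡ g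
    deck-fibre-index ((v , σ) , _) = ΣT-≡ (cong (v ,_) (shift-level-embed-reduce σ))

    sheeted : IsSheeted G H fV N
    sheeted h = mk↔ₛ′ to from to∘from from∘to
      where
      to : Fin N → Σ (V G) (λ g → fV g ≡ h)
      to i = dV (deck i) (liftH h) , trans (overV (deck i) (liftH h)) (fV∘liftH h)
      from : Σ (V G) (λ g → fV g ≡ h) → Fin N
      from (g , _) = fibre-index g
      to∘from : ∀ y → to (from y) ≡ y
      to∘from (g , refl) = fibre-≡ (ΣT-≟ (≡-dec _≟_ _≟_)) (deck-fibre-index g)
      from∘to : ∀ i → from (to i) ≡ i
      from∘to i = fibre-index-deck i h

    deck-group : DeckGroup≅ℤ/ G H fV fE N
    deck-group = deck , deck-hom , deck-injective , deck-surjective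
      where
      g₀ : V G
      g₀ = liftH (nonempty c₀)
      deck-hom : ∀ i j → (∀ v → dV (deck (add N i j)) v ≡ dV (deck i) (dV (deck j) v)) ×
                         (∀ e → dE (deck (add N i j)) e ≡ dE (deck i) (dE (deck j) e))
      deck-hom i j = (λ { ((v , σ) , _) → ΣT-≡ (cong (v ,_) (shift-hom i j σ)) })
                   , (λ { ((x , σ) , _) → ΣT-≡ (cong (x ,_) (shift-hom i j σ)) })
      deck-injective : ∀ i j → deck i ≈D deck j → i ≡ j
      deck-injective i j (same-dV , _) = begin
        i                                ≡⟨ fibre-index-deck i (nonempty c₀) ⟨
        fibre-index (dV (deck i) g₀)     ≡⟨ cong fibre-index (same-dV g₀) ⟩
        fibre-index (dV (deck j) g₀)     ≡⟨ fibre-index-deck j (nonempty c₀) ⟩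
        j                                ∎
        where open ≡-Reasoning
      deck-surjective : ∀ δ → ∃ λ i → deck i ≈D δ
      deck-surjective δ = i ,
        deck-determined covering (component-connected S-component) (deck i) δ g₀
          (subst (λ h → dV (deck i) (liftH h) ≡ dV δ g₀)
                 (trans (overV δ g₀) (fV∘liftH (nonempty c₀)))
                 (deck-fibre-index (dV δ g₀)))
        where
        i : Fin N
        i = fibre-index (dV δ g₀)

corollary4p7 : (p : ℕ) (pr : Prime p) (X : FinGraph) → IsConnectedGraph (Base X) →
    let open Tower p pr in
    (a : Voltage X) (m₀ : ℕ) →
    (∃ λ k → ∀ n → m₀ ≤ n → HasComponents (Derived X a n) k) →
    (S₀ : V (Derived X a m₀) → Bool) (c₀ : IsComponent (Derived X a m₀) S₀) →
    ∀ m → m₀ ≤ m →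
    Σ (V (Derived X a m) → Bool) λ S →
    Σ (IsComponent (Derived X a m) S) λ c →
    Σ (MapsInto {X} {a} m m₀ S S₀) λ into →
      IsGaloisCyclic (Sub (Derived X a m) S (closed c))
                     (Sub (Derived X a m₀) S₀ (closed c₀))
                     (πV∣ {X} {a} m m₀ {S} {S₀} into) (πE∣ {X} {a} m m₀ {S} {S₀} into)
                     (p ^ (m ∸ m₀)) {{pⁿ≢0 (m ∸ m₀)}}
      × (∀ S′ → IsComponent (Derived X a m) S′ → MapsInto {X} {a} m m₀ S′ S₀ →
           Surjects {X} {a} m m₀ S′ S₀ → ∀ v → S′ v ≡ S v)
corollary4p7 p pr X _ a m₀ (k , components) S₀ c₀ m m₀≤m =
  S , S-component , S-maps-into , (covering , sheeted , deck-group) ,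
  λ S′ c′ S′↦S₀ _ → component-unique S-component c′ S′↦S₀
  where
  open Projection X a m₀≤m
  open Preimage S₀ c₀ (components m m₀≤m) (components m₀ ≤-refl)
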